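{- There is no MSO encoding of the class of trees of height at most one into the class of binary trees.
   Context: Trees are finite rooted unranked unordered unlabelled trees, represented as structures whose universe is the set of nodes with a binary parent relation. Trees of height at most one are those in which every root-to-leaf path has at most one edge. Binary trees are trees in which every node has at most two children (no sibling order). MSO means monadic second-order logic with modulo-counting predicates. An MSO transduction is a binary relation between structures (closed under isomorphism) obtained by composing finitely many MSO interpretations, filterings by MSO sentences, $k$-copyings and $k$-colourings. An MSO encoding of $\mathcal C$ into $\mathcal D$ is an MSO transduction $f$ with all outputs on $\mathcal C$ in $\mathcal D$, for which there is an MSO transduction $g$ with all outputs on $\mathcal D$ in $\mathcal C$ such that $f$ followed by $g$ is the identity on $\mathcal C$ (up to isomorphism). -}

module Defs where

open import Data.Nat using (ℕ; zero; suc; _+_; _%_)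
open import Data.Fin using (Fin; zero; suc; splitAt; _↑ˡ_; _↑ʳ_)
open import Data.Fin.Properties using (splitAt-↑ˡ; splitAt-↑ʳ)
open import Data.Vec using (Vec; []; _∷_; map; lookup)
open import Data.Vec.Relation.Unary.All using (All)
open import Data.Product using (Σ; _×_; _,_; proj₁; proj₂)
open import Data.Sum using (_⊎_; inj₁; inj₂; [_,_]) renaming (map to ⊎map)
open import Data.Unit using (⊤; tt)
open import Data.Bool using (Bool; true; false; if_then_else_)
open import Data.Empty using (⊥)
open import Function using (_∘_; id)
open import Relation.Binary.PropositionalEquality using (_≡_; _≢_; refl; trans; cong)
open import Relation.Nullary using (¬_)
open import Function.Bundles using (_↔_; _⇔_; Inverse)
open import Function.Definitions using (Injective)

record Sig : Set₁ where
  field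
    Sym       : Set
    ar        : Sym → ℕ
    -- the vocabulary is finite: Sym is enumerated by some Fin size
    size      : ℕ
    enum      : Fin size → Sym
    enum-onto : ∀ s → Σ (Fin size) λ i → enum i ≡ s
open Sig public

_⊕_ : Sig → Sig → Sig
σ ⊕ τ = record
  { Sym = Sym σ ⊎ Sym τ
  ; ar = [ ar σ , ar τ ]
  ; size = size σ + size τ
  ; enum = en
  ; enum-onto = onto }
  where
  en : Fin (size σ + size τ) → Sym σ ⊎ Sym τ
  en i = ⊎map (enum σ) (enum τ) (splitAt (size σ) i)
  onto : ∀ s → Σ (Fin (size σ + size τ)) λ i → en i ≡ s
  onto (inj₁ a) with enum-onto σ a
  ... | i , p = i ↑ˡ size τ
              , trans (cong (⊎map (enum σ) (enum τ)) (splitAt-↑ˡ (size σ) i (size τ))) (cong inj₁ p)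
  onto (inj₂ b) with enum-onto τ b
  ... | i , p = size σ ↑ʳ i
              , trans (cong (⊎map (enum σ) (enum τ)) (splitAt-↑ʳ (size σ) (size τ) i)) (cong inj₂ p)

unarySig : ℕ → Sig
unarySig k = record { Sym = Fin k ; ar = λ _ → 1 ; size = k ; enum = id ; enum-onto = λ s → s , refl }

binSig : Sig
binSig = record { Sym = ⊤ ; ar = λ _ → 2 ; size = 1 ; enum = λ _ → tt ; enum-onto = λ { tt → zero , refl } }

-- vocabulary of trees: one binary relation, the parent relation
treeSig : Sig
treeSig = binSig

-- vocabulary produced by copying: old symbols, the binary "copy" relation,
-- and one unary "layer" predicate per copy
copySig : Sig → ℕ → Sig
copySig σ k = σ ⊕ (binSig ⊕ unarySig k)

colourSig : Sig → ℕ → Sig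
colourSig σ k = σ ⊕ unarySig k

Structure : Sig → ℕ → Set
Structure σ n = (r : Sym σ) → Vec (Fin n) (ar σ r) → Bool

Str : Sig → Set
Str σ = Σ ℕ (Structure σ)

Iso : ∀ σ → Str σ → Str σ → Set
Iso σ (n , A) (m , B) =
  Σ (Fin n ↔ Fin m) λ e → ∀ (r : Sym σ) v → A r v ≡ B r (map (Inverse.to e) v)

-- MSO with modulo-counting predicates.
-- Formula σ i j : formulas with i free first-order and j free set variables
-- (de Bruijn indices).

data Formula (σ : Sig) : ℕ → ℕ → Set where
  rel   : ∀ {i j} (r : Sym σ) → Vec (Fin i) (ar σ r) → Formula σ i j
  eq    : ∀ {i j} → Fin i → Fin i → Formula σ i j
  mem   : ∀ {i j} → Fin i → Fin j → Formula σ i j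
  -- modc m k X :  |X| ≡ k  (mod (m+1))
  modc  : ∀ {i j} → ℕ → ℕ → Fin j → Formula σ i j
  neg   : ∀ {i j} → Formula σ i j → Formula σ i j
  and   : ∀ {i j} → Formula σ i j → Formula σ i j → Formula σ i j
  exFO  : ∀ {i j} → Formula σ (suc i) j → Formula σ i j
  exSO  : ∀ {i j} → Formula σ i (suc j) → Formula σ i j

card : ∀ {n} → (Fin n → Bool) → ℕ
card {zero}  X = 0
card {suc n} X = (if X zero then 1 else 0) + card (λ i → X (suc i))

Sat : ∀ {σ n i j} → Structure σ n → Vec (Fin n) i → Vec (Fin n → Bool) j → Formula σ i j → Set
Sat A ρ η (rel r xs)   = A r (map (lookup ρ) xs) ≡ true
Sat A ρ η (eq x y)     = lookup ρ x ≡ lookup ρ y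
Sat A ρ η (mem x X)    = lookup η X (lookup ρ x) ≡ true
Sat A ρ η (modc m k X) = card (lookup η X) % suc m ≡ k
Sat A ρ η (neg φ)      = ¬ Sat A ρ η φ
Sat A ρ η (and φ ψ)    = Sat A ρ η φ × Sat A ρ η ψ
Sat {n = n} A ρ η (exFO φ) = Σ (Fin n) λ a → Sat A (a ∷ ρ) η φ
Sat {n = n} A ρ η (exSO φ) = Σ (Fin n → Bool) λ X → Sat A ρ (X ∷ η) φ

record Interp (σ τ : Sig) : Set where
  field
    dom  : Formula σ 1 0
    rels : (r : Sym τ) → Formula σ (ar τ r) 0

data Step : Sig → Sig → Set₁ where
  interp : ∀ {σ τ} → Interp σ τ → Step σ τ
  filter : ∀ {σ} → Formula σ 0 0 → Step σ σ
  copy   : ∀ {σ} (k : ℕ) → Step σ (copySig σ (suc k))  -- (k+1)-copying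
  colour : ∀ {σ} (k : ℕ) → Step σ (colourSig σ k)

-- semantics (as relations, closed under isomorphism of outputs)
StepRel : ∀ {σ τ} → Step σ τ → Str σ → Str τ → Set
StepRel {σ} {τ} (interp I) (n , A) (m , B) =
  Σ (Fin m → Fin n) λ e →
    Injective {A = Fin m} {B = Fin n} _≡_ _≡_ e
    × (∀ a → Sat A (a ∷ []) [] (Interp.dom I) ⇔ (Σ (Fin m) λ b → e b ≡ a))
    × (∀ (r : Sym τ) v → (B r v ≡ true) ⇔ Sat A (map e v) [] (Interp.rels I r))
StepRel {σ} (filter φ) (n , A) (m , B) = Sat A [] [] φ × Iso σ (n , A) (m , B)
StepRel {σ} (copy k) (n , A) (m , B) =
  Σ (Fin m ↔ (Fin n × Fin (suc k))) λ e →
    let h = Inverse.to e in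
    -- original relations live on the first copy
    (∀ (r : Sym σ) v → (B (inj₁ r) v ≡ true)
        ⇔ (A r (map (proj₁ ∘ h) v) ≡ true × All (λ x → proj₂ (h x) ≡ zero) v))
    -- copy(x,y) : x and y are copies of the same element
    × (∀ v → (B (inj₂ (inj₁ tt)) v ≡ true)
        ⇔ (proj₁ (h (lookup v zero)) ≡ proj₁ (h (lookup v (suc zero)))))
    -- layer_i(x) : x lies in the i-th copy
    × (∀ i v → (B (inj₂ (inj₂ i)) v ≡ true) ⇔ (proj₂ (h (lookup v zero)) ≡ i))
StepRel {σ} (colour k) (n , A) (m , B) =
  Σ (Fin m ↔ Fin n) λ e →
    let h = Inverse.to e in
    Σ (Fin n → Fin k) λ c →
      (∀ (r : Sym σ) v → B (inj₁ r) v ≡ A r (map h v))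
      × (∀ i v → (B (inj₂ i) v ≡ true) ⇔ (c (h (lookup v zero)) ≡ i))

data Transduction : Sig → Sig → Set₁ where
  done : ∀ {σ} → Transduction σ σ
  _then_ : ∀ {σ ρ τ} → Step σ ρ → Transduction ρ τ → Transduction σ τ

⟦_⟧ : ∀ {σ τ} → Transduction σ τ → Str σ → Str τ → Set
⟦_⟧ {σ} done A B = Iso σ A B
⟦ _then_ {ρ = ρ} s t ⟧ A B = Σ (Str ρ) λ C → StepRel s A C × ⟦ t ⟧ C B

IsMSOEncoding : ∀ {σ τ} → (Str σ → Set) → (Str τ → Set) → Transduction σ τ → Set₁
IsMSOEncoding {σ} {τ} C D f =
  Σ (Transduction τ σ) λ g →
    (∀ A → C A → ∀ B → ⟦ f ⟧ A B → D B)
    × (∀ B → D B → ∀ A → ⟦ g ⟧ B A → C A)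
    × (∀ A → C A → ∀ A' → (Σ (Str τ) λ B → ⟦ f ⟧ A B × ⟦ g ⟧ B A') ⇔ Iso σ A A')

Parent : ∀ {n} → Structure treeSig n → Fin n → Fin n → Set
Parent A x y = A tt (x ∷ y ∷ []) ≡ true      -- x is the parent of y

data Reach {n} (A : Structure treeSig n) : Fin n → Fin n → Set where
  here : ∀ {x} → Reach A x x
  step : ∀ {x y z} → Parent A x y → Reach A y z → Reach A x z

IsTree : Str treeSig → Set
IsTree (n , A) =
  Σ (Fin n) λ root →
    (∀ x → ¬ Parent A x root)
    × (∀ y → y ≢ root → Σ (Fin n) λ x → Parent A x y × (∀ x' → Parent A x' y → x' ≡ x))
    × (∀ y → Reach A root y)

IsTreeHeight≤1 : Str treeSig → Set
IsTreeHeight≤1 (n , A) = IsTree (n , A) × (∀ x y z → Parent A x y → Parent A y z → ⊥)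

IsBinaryTree : Str treeSig → Set
IsBinaryTree (n , A) =
  IsTree (n , A)
  × (∀ x y₁ y₂ y₃ → Parent A x y₁ → Parent A x y₂ → Parent A x y₃
       → y₁ ≡ y₂ ⊎ y₁ ≡ y₃ ⊎ y₂ ≡ y₃)

{-# OPTIONS --safe #-}
module Submission where

-- Every permutation of the leaves of a star is an automorphism. Along an MSO
-- transduction we track an injective map sending each output element to an input
-- node and a copy index, such that every permutation of the input nodes preserving
-- a finite colouring of them lifts to an automorphism of the output.
-- Interpretations, filters and copyings keep this property; a colouring keeps it
-- after refining the colouring of the input nodes, by a number of classes that does
-- not depend on the input. A 3-cycle of three nodes of one class lifts to an
-- automorphism whose cube is the identity, and such an automorphism of a binary
-- tree is the identity. So each class contains at most two nodes carrying output
-- elements, and the binary tree obtained from a star has size bounded independently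
-- of the star. Decoding enlarges structures by a bounded factor only, so it cannot
-- give back a star with more leaves than that.

open import Data.Bool using (Bool; true; false; if_then_else_; T; _∧_; not)
open import Data.Empty using (⊥; ⊥-elim)
open import Data.Fin using (Fin; zero; suc; combine; funToFin; finToFun; _<_)
open import Data.Fin.Permutation
  using (Permutation′; _⟨$⟩ʳ_; _⟨$⟩ˡ_; inverseˡ; inverseʳ; permutation; flip)
open import Data.Fin.Properties
  using ( _≟_; _<?_; <-cmp; <⇒≢; <-trans; suc-injective; any?; injective⇒≤
        ; combine-injective; finToFun-funToFin; *↔×; 2↔Bool)
open import Data.Nat using (ℕ; zero; suc; _+_; _*_; _^_; _%_; _≤_)
open import Data.Nat.Properties
  using (+-0-commutativeMonoid; <-irrefl; n<1+n; *-monoˡ-≤; module ≤-Reasoning)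
open import Algebra.Properties.CommutativeMonoid.Sum +-0-commutativeMonoid using (sum; sum-permute)
open import Data.Product using (Σ; _×_; _,_; proj₁; proj₂; map₁)
open import Data.Product.Function.NonDependent.Propositional using (_×-⇔_)
open import Data.Product.Properties using (≡-dec)
open import Data.Sum using (inj₁; inj₂)
open import Data.Unit using (tt)
open import Data.Vec using (Vec; []; _∷_; map; lookup)
open import Data.Vec.Properties using (map-∘; map-cong; map-id; lookup-map)
open import Data.Vec.Relation.Unary.All as All using (All)
open import Data.Vec.Relation.Unary.All.Properties using (map⁺; map⁻)
open import Defs
open import Function using (_∘_)
open import Function.Bundles using (_⇔_; _↔_; mk⇔; Equivalence; Inverse; Injection)
open import Function.Properties.Equivalence using (⇔-setoid)
open import Function.Properties.Inverse using (↔⇒↣; ↔-sym; ↔-refl)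
open import Function.Related.TypeIsomorphisms using (¬-cong-⇔)
open import Level using (0ℓ)
open import Relation.Binary.Definitions using (tri<; tri≈; tri>)
open import Relation.Binary.PropositionalEquality
  using (_≡_; _≢_; _≗_; refl; sym; trans; cong; cong₂; subst; ≢-sym; module ≡-Reasoning)
import Relation.Binary.Reasoning.Setoid
open import Relation.Nullary using (¬_; Dec; yes; no)
open import Relation.Nullary.Decidable using (_×-dec_; isYes; toWitness; fromWitness)

open Equivalence using (to; from)
module ⇔-Reasoning = Relation.Binary.Reasoning.Setoid (⇔-setoid 0ℓ)

true-⇔⇒≡ : ∀ {b b′ : Bool} {X Y : Set} →
  (b ≡ true) ⇔ X → (b′ ≡ true) ⇔ Y → X ⇔ Y → b ≡ b′
true-⇔⇒≡ {false} {false} _   _    _   = refl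
true-⇔⇒≡ {true}  {true}  _   _    _   = refl
true-⇔⇒≡ {false} {true}  b⇔X b′⇔Y X⇔Y = from b⇔X (from X⇔Y (to b′⇔Y refl))
true-⇔⇒≡ {true}  {false} b⇔X b′⇔Y X⇔Y = sym (from b′⇔Y (to X⇔Y (to b⇔X refl)))

map-commute : ∀ {A B C D : Set} {f : B → D} {g : A → B} {h : C → D} {k : A → C} →
  (∀ x → f (g x) ≡ h (k x)) → ∀ {n} (v : Vec A n) → map f (map g v) ≡ map h (map k v)
map-commute {f = f} {g} {h} {k} fg≗hk v =
  trans (sym (map-∘ f g v)) (trans (map-cong fg≗hk v) (map-∘ h k v))

↔-injective : ∀ {A B : Set} (e : A ↔ B) {x y} → Inverse.to e x ≡ Inverse.to e y → x ≡ y
↔-injective e = Injection.injective (↔⇒↣ e)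

All-map-⇔ : ∀ {A : Set} {Q : A → Set} {f : A → A} → (∀ x → Q (f x) ⇔ Q x) →
  ∀ {n} (v : Vec A n) → All Q (map f v) ⇔ All Q v
All-map-⇔ Qf⇔Q v = mk⇔ (All.map (to (Qf⇔Q _)) ∘ map⁻) (map⁺ ∘ All.map (from (Qf⇔Q _)))

≡⇒⇔ : ∀ {A : Set} {x y c : A} → x ≡ y → (x ≡ c) ⇔ (y ≡ c)
≡⇒⇔ x≡y = mk⇔ (trans (sym x≡y)) (trans x≡y)

Iso-refl : ∀ σ (A : Str σ) → Iso σ A A
Iso-refl _ (_ , A) = ↔-refl , λ r v → cong (A r) (sym (map-id v))

card≡sum : ∀ {n} (X : Fin n → Bool) → card X ≡ sum (λ i → if X i then 1 else 0)
card≡sum {zero}  X = refl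
card≡sum {suc n} X = cong ((if X zero then 1 else 0) +_) (card≡sum (X ∘ suc))

card-cong : ∀ {n} {X Y : Fin n → Bool} → X ≗ Y → card X ≡ card Y
card-cong {zero}  X≗Y = refl
card-cong {suc n} X≗Y =
  cong₂ _+_ (cong (λ b → if b then 1 else 0) (X≗Y zero)) (card-cong (X≗Y ∘ suc))

card-permute : ∀ {n} (π : Permutation′ n) (X : Fin n → Bool) → card (X ∘ (π ⟨$⟩ʳ_)) ≡ card X
card-permute π X =
  trans (card≡sum (X ∘ (π ⟨$⟩ʳ_))) (trans (sym (sum-permute _ π)) (sym (card≡sum X)))

-- Automorphisms preserve MSO truth

record Automorphism (σ : Sig) {n} (A : Structure σ n) : Set where
  field
    perm      : Permutation′ n
    preserves : ∀ r v → A r (map (perm ⟨$⟩ʳ_) v) ≡ A r v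

module _ {σ n} {A : Structure σ n} (α : Automorphism σ A) where
  open Automorphism α

  Sat-automorphism : ∀ {i j} (φ : Formula σ i j) {ρ ρ′ : Vec (Fin n) i}
    {η η′ : Vec (Fin n → Bool) j} →
    (∀ k → lookup ρ′ k ≡ perm ⟨$⟩ʳ lookup ρ k) →
    (∀ k x → lookup η′ k (perm ⟨$⟩ʳ x) ≡ lookup η k x) →
    Sat A ρ η φ ⇔ Sat A ρ′ η′ φ
  Sat-automorphism (rel r xs) {ρ} {ρ′} hρ hη = ≡⇒⇔ (sym (begin
      A r (map (lookup ρ′) xs)                     ≡⟨ cong (A r) (map-cong hρ xs) ⟩
      A r (map ((perm ⟨$⟩ʳ_) ∘ lookup ρ) xs)       ≡⟨ cong (A r) (map-∘ _ _ xs) ⟩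
      A r (map (perm ⟨$⟩ʳ_) (map (lookup ρ) xs))   ≡⟨ preserves r _ ⟩
      A r (map (lookup ρ) xs)                      ∎))
    where open ≡-Reasoning
  Sat-automorphism (eq x y) hρ hη = mk⇔
    (λ x≡y → trans (hρ x) (trans (cong (perm ⟨$⟩ʳ_) x≡y) (sym (hρ y))))
    (λ x≡y′ → trans (sym (inverseˡ perm))
                (trans (cong (perm ⟨$⟩ˡ_) (trans (sym (hρ x)) (trans x≡y′ (hρ y)))) (inverseˡ perm)))
  Sat-automorphism (mem x X) {η′ = η′} hρ hη =
    ≡⇒⇔ (sym (trans (cong (lookup η′ X) (hρ x)) (hη X _)))
  Sat-automorphism (modc m k X) {η = η} {η′} hρ hη = ≡⇒⇔ (sym (cong (_% suc m) card≡))
    where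
    card≡ : card (lookup η′ X) ≡ card (lookup η X)
    card≡ = trans (sym (card-permute perm _)) (card-cong (hη X))
  Sat-automorphism (neg φ) hρ hη = ¬-cong-⇔ (Sat-automorphism φ hρ hη)
  Sat-automorphism (and φ ψ) hρ hη = Sat-automorphism φ hρ hη ×-⇔ Sat-automorphism ψ hρ hη
  Sat-automorphism (exFO φ) hρ hη = mk⇔
    (λ (x , p) → perm ⟨$⟩ʳ x ,
       to (Sat-automorphism φ (λ { zero → refl ; (suc k) → hρ k }) hη) p)
    (λ (x , p) → perm ⟨$⟩ˡ x ,
       from (Sat-automorphism φ (λ { zero → sym (inverseʳ perm) ; (suc k) → hρ k }) hη) p)
  Sat-automorphism (exSO φ) hρ hη = mk⇔
    (λ (X , p) → X ∘ (perm ⟨$⟩ˡ_) ,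
       to (Sat-automorphism φ hρ (λ { zero x → cong X (inverseˡ perm) ; (suc k) → hη k })) p)
    (λ (X , p) → X ∘ (perm ⟨$⟩ʳ_) ,
       from (Sat-automorphism φ hρ (λ { zero x → refl ; (suc k) → hη k })) p)

  Sat-map-automorphism : ∀ {i} (φ : Formula σ i 0) (ρ : Vec (Fin n) i) →
    Sat A ρ [] φ ⇔ Sat A (map (perm ⟨$⟩ʳ_) ρ) [] φ
  Sat-map-automorphism φ ρ = Sat-automorphism φ (λ k → lookup-map k _ ρ) (λ ())

ClassPreserving : ∀ {n N} → (Fin n → Fin N) → Permutation′ n → Set
ClassPreserving cl π = ∀ x → cl (π ⟨$⟩ʳ x) ≡ cl x

flip-ClassPreserving : ∀ {n N} {cl : Fin n → Fin N} (π : Permutation′ n) →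
  ClassPreserving cl π → ClassPreserving cl (flip π)
flip-ClassPreserving {cl = cl} π cp x = trans (sym (cp (π ⟨$⟩ˡ x))) (cong cl (inverseʳ π))

record Lift (σ : Sig) {m n P} (B : Structure σ m) (origin : Fin m → Fin n × Fin P)
            (π : Permutation′ n) : Set where
  field
    lifted    : Fin m → Fin m
    commutes  : ∀ b → origin (lifted b) ≡ map₁ (π ⟨$⟩ʳ_) (origin b)
    preserves : ∀ r v → B r (map lifted v) ≡ B r v
open Lift using (lifted; commutes)

-- The invariant carried along a transduction whose input has universe Fin n: each
-- element of B has an origin node and a copy index, and the class-preserving
-- permutations of the nodes act on B through origin.
record Equivariant (σ : Sig) {m} (B : Structure σ m) {n N} (cl : Fin n → Fin N) (P : ℕ) : Set where
  field
    origin           : Fin m → Fin n × Fin P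
    origin-injective : ∀ {a b} → origin a ≡ origin b → a ≡ b
    lift             : ∀ π → ClassPreserving cl π → Lift σ B origin π

module _ {σ m n N P} {B : Structure σ m} {cl : Fin n → Fin N} (E : Equivariant σ B cl P) where
  open Equivariant E

  lift-inverse : ∀ {π ρ} (cpπ : ClassPreserving cl π) (cpρ : ClassPreserving cl ρ) →
    (∀ x → π ⟨$⟩ʳ (ρ ⟨$⟩ʳ x) ≡ x) →
    ∀ b → lifted (lift π cpπ) (lifted (lift ρ cpρ) b) ≡ b
  lift-inverse {π} {ρ} cpπ cpρ πρ≗id b = origin-injective (begin
    origin (lifted Lπ (lifted Lρ b))           ≡⟨ commutes Lπ _ ⟩
    map₁ (π ⟨$⟩ʳ_) (origin (lifted Lρ b))      ≡⟨ cong (map₁ (π ⟨$⟩ʳ_)) (commutes Lρ b) ⟩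
    map₁ (π ⟨$⟩ʳ_) (map₁ (ρ ⟨$⟩ʳ_) (origin b)) ≡⟨ cong (_, proj₂ (origin b)) (πρ≗id _) ⟩
    origin b                                   ∎)
    where
    open ≡-Reasoning
    Lπ = lift π cpπ
    Lρ = lift ρ cpρ

  lift-automorphism : ∀ π → ClassPreserving cl π → Automorphism σ B
  lift-automorphism π cp = record
    { perm      = permutation (lifted (lift π cp)) (lifted (lift (flip π) cp⁻¹))
                    (lift-inverse cp cp⁻¹ (λ _ → inverseʳ π))
                    (lift-inverse cp⁻¹ cp (λ _ → inverseˡ π))
    ; preserves = Lift.preserves (lift π cp) }
    where
    cp⁻¹ = flip-ClassPreserving π cp

symmetric-Equivariant : ∀ {σ m N} {A : Structure σ m} {cl : Fin m → Fin N} →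
  (∀ π → ClassPreserving cl π → ∀ r v → A r (map (π ⟨$⟩ʳ_) v) ≡ A r v) → Equivariant σ A cl 1
symmetric-Equivariant symmetric = record
  { origin           = λ x → x , zero
  ; origin-injective = cong proj₁
  ; lift             = λ π cp → record
      { lifted    = π ⟨$⟩ʳ_
      ; commutes  = λ _ → refl
      ; preserves = symmetric π cp } }

discrete-Equivariant : ∀ {σ m} (A : Structure σ m) → Equivariant σ A (λ x → x) 1
discrete-Equivariant A =
  symmetric-Equivariant λ π π≗id r v → cong (A r) (trans (map-cong π≗id v) (map-id v))

-- Every step of a transduction preserves equivariance

module _ {n N P : ℕ} {cl : Fin n → Fin N} where

  iso-Equivariant : ∀ {σ m m′} {A : Structure σ m} {B : Structure σ m′} →
    Iso σ (m , A) (m′ , B) → Equivariant σ A cl P → Equivariant σ B cl P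
  iso-Equivariant {σ} {A = A} {B} (e , A≡B) E = record
    { origin           = origin ∘ (e ⟨$⟩ˡ_)
    ; origin-injective = ↔-injective (flip e) ∘ origin-injective
    ; lift             = λ π cp → lift′ (lift π cp) }
    where
    open Equivariant E
    B≡A : ∀ r w → B r w ≡ A r (map (e ⟨$⟩ˡ_) w)
    B≡A r w = begin
      B r w                                  ≡⟨ cong (B r) e∘e⁻¹ ⟨
      B r (map (e ⟨$⟩ʳ_) (map (e ⟨$⟩ˡ_) w))  ≡⟨ A≡B r _ ⟨
      A r (map (e ⟨$⟩ˡ_) w)                  ∎
      where
      open ≡-Reasoning
      e∘e⁻¹ = trans (sym (map-∘ _ _ w)) (trans (map-cong (λ _ → inverseʳ e) w) (map-id w))
    lift′ : ∀ {π} → Lift σ A origin π → Lift σ B (origin ∘ (e ⟨$⟩ˡ_)) π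
    lift′ L = record
      { lifted    = (e ⟨$⟩ʳ_) ∘ lifted L ∘ (e ⟨$⟩ˡ_)
      ; commutes  = λ b → trans (cong origin (inverseˡ e)) (commutes L _)
      ; preserves = λ r v → begin
          B r (map ((e ⟨$⟩ʳ_) ∘ lifted L ∘ (e ⟨$⟩ˡ_)) v)   ≡⟨ B≡A r _ ⟩
          A r (map (e ⟨$⟩ˡ_) (map ((e ⟨$⟩ʳ_) ∘ lifted L ∘ (e ⟨$⟩ˡ_)) v))
            ≡⟨ cong (A r) (map-commute (λ _ → inverseˡ e) v) ⟩
          A r (map (lifted L) (map (e ⟨$⟩ˡ_) v))           ≡⟨ Lift.preserves L r _ ⟩
          A r (map (e ⟨$⟩ˡ_) v)                            ≡⟨ B≡A r v ⟨
          B r v                                            ∎ }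
      where open ≡-Reasoning

  interp-Equivariant : ∀ {σ τ m m′} {A : Structure σ m} {B : Structure τ m′} (I : Interp σ τ) →
    StepRel (interp I) (m , A) (m′ , B) → Equivariant σ A cl P → Equivariant τ B cl P
  interp-Equivariant {σ} {τ} {A = A} {B} I (e , e-injective , in-domain , B⇔A) E = record
    { origin           = origin ∘ e
    ; origin-injective = e-injective ∘ origin-injective
    ; lift             = lift′ }
    where
    open Equivariant E
    open Interp I
    lift′ : ∀ π → ClassPreserving cl π → Lift τ B (origin ∘ e) π
    lift′ π cp = record
      { lifted    = lifted′
      ; commutes  = λ b → trans (cong origin (e-lifted b)) (commutes (lift π cp) (e b))
      ; preserves = λ r v → true-⇔⇒≡ (B⇔A r (map lifted′ v)) (B⇔A r v) (begin
          Sat A (map e (map lifted′ v)) [] (rels r)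
            ≡⟨ cong (λ w → Sat A w [] _) (map-commute e-lifted v) ⟩
          Sat A (map (perm ⟨$⟩ʳ_) (map e v)) [] (rels r)  ≈⟨ Sat-map-automorphism α _ _ ⟨
          Sat A (map e v) [] (rels r)                     ∎) }
      where
      α = lift-automorphism E π cp
      open Automorphism α
      image : ∀ b → Σ (Fin _) λ b′ → e b′ ≡ perm ⟨$⟩ʳ e b
      image b = to (in-domain _)
        (to (Sat-map-automorphism α dom (e b ∷ [])) (from (in-domain (e b)) (b , refl)))
      lifted′ = proj₁ ∘ image
      e-lifted : ∀ b → e (lifted′ b) ≡ perm ⟨$⟩ʳ e b
      e-lifted = proj₂ ∘ image
      open ⇔-Reasoning

  copy-Equivariant : ∀ {σ m m′} (k : ℕ) {A : Structure σ m} {B : Structure (copySig σ (suc k)) m′} →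
    StepRel (copy {σ} k) (m , A) (m′ , B) → Equivariant σ A cl P →
    Equivariant (copySig σ (suc k)) B cl (P * suc k)
  copy-Equivariant {σ} k {A} {B} (e , rels , copies , layers) E = record
    { origin           = layered ∘ h
    ; origin-injective = λ eq′ → ↔-injective e (layered-injective eq′)
    ; lift             = lift′ }
    where
    open Equivariant E
    h = Inverse.to e
    layered : Fin _ × Fin (suc k) → Fin n × Fin (P * suc k)
    layered (a , i) = proj₁ (origin a) , combine (proj₂ (origin a)) i
    layered-injective : ∀ {q q′} → layered q ≡ layered q′ → q ≡ q′
    layered-injective {a , i} {a′ , i′} eq′ =
      let (p≡p′ , i≡i′) = combine-injective _ _ _ _ (cong proj₂ eq′)
      in cong₂ _,_ (origin-injective (cong₂ _,_ (cong proj₁ eq′) p≡p′)) i≡i′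
    lift′ : ∀ π → ClassPreserving cl π → Lift (copySig σ (suc k)) B (layered ∘ h) π
    lift′ π cp = record
      { lifted    = lifted′
      ; commutes  = λ b → trans (cong layered (h-lifted b))
                      (cong (λ o → proj₁ o , combine (proj₂ o) (proj₂ (h b))) (commutes (lift π cp) _))
      ; preserves = preserves′ }
      where
      α = lift-automorphism E π cp
      φ = Automorphism.perm α ⟨$⟩ʳ_
      lifted′ = Inverse.from e ∘ map₁ φ ∘ h
      h-lifted : ∀ b → h (lifted′ b) ≡ map₁ φ (h b)
      h-lifted b = Inverse.strictlyInverseˡ e _
      copy-lifted : ∀ b → proj₁ (h (lifted′ b)) ≡ φ (proj₁ (h b))
      copy-lifted = cong proj₁ ∘ h-lifted
      layer-lifted : ∀ b → proj₂ (h (lifted′ b)) ≡ proj₂ (h b)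
      layer-lifted = cong proj₂ ∘ h-lifted
      preserves′ : ∀ r v → B r (map lifted′ v) ≡ B r v
      preserves′ (inj₁ r) v = true-⇔⇒≡ (rels r (map lifted′ v)) (rels r v)
        (≡⇒⇔ (trans (cong (A r) (map-commute copy-lifted v)) (Automorphism.preserves α r _))
          ×-⇔ All-map-⇔ (λ x → ≡⇒⇔ (layer-lifted x)) v)
      preserves′ (inj₂ (inj₁ tt)) (x ∷ y ∷ []) = true-⇔⇒≡ (copies _) (copies _) (mk⇔
        (λ p → ↔-injective (Automorphism.perm α)
                 (trans (sym (copy-lifted x)) (trans p (copy-lifted y))))
        (λ p → trans (copy-lifted x) (trans (cong φ p) (sym (copy-lifted y)))))
      preserves′ (inj₂ (inj₂ i)) (x ∷ []) =
        true-⇔⇒≡ (layers i _) (layers i _) (≡⇒⇔ (layer-lifted x))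

  colour-Equivariant : ∀ {σ m m′} (k : ℕ) {A : Structure σ m} {B : Structure (colourSig σ k) m′} →
    StepRel (colour {σ} k) (m , A) (m′ , B) → Equivariant σ A cl P →
    Σ (Fin n → Fin (N * (suc k ^ P))) λ cl′ → Equivariant (colourSig σ k) B cl′ P
  colour-Equivariant {σ} k {A} {B} (e , c , rels , colours) E = cl′ , record
    { origin           = origin ∘ h
    ; origin-injective = ↔-injective e ∘ origin-injective
    ; lift             = lift′ }
    where
    open Equivariant E
    h = Inverse.to e
    -- The colour of the element with origin (x , p), shifted by one; zero if there is none.
    signature : Fin n → Fin P → Fin (suc k)
    signature x p with any? (λ a → ≡-dec _≟_ _≟_ (origin a) (x , p))
    ... | yes (a , _) = suc (c a)
    ... | no _        = zero
    signature-origin : ∀ a {x p} → origin a ≡ (x , p) → signature x p ≡ suc (c a)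
    signature-origin a {x} {p} a↦xp with any? (λ a → ≡-dec _≟_ _≟_ (origin a) (x , p))
    ... | yes (a′ , a′↦xp) = cong (suc ∘ c) (origin-injective (trans a′↦xp (sym a↦xp)))
    ... | no ∄a            = ⊥-elim (∄a (a , a↦xp))
    cl′ : Fin n → Fin (N * (suc k ^ P))
    cl′ x = combine (cl x) (funToFin (signature x))
    cl′-injective : ∀ {x y} → cl′ x ≡ cl′ y → cl x ≡ cl y × signature x ≗ signature y
    cl′-injective {x} {y} x~y =
      let (cl≡ , sig≡) = combine-injective (cl x) _ (cl y) _ x~y
      in cl≡ , λ p → trans (sym (finToFun-funToFin (signature x) p))
                       (trans (cong (λ i → finToFun i p) sig≡) (finToFun-funToFin (signature y) p))
    lift′ : ∀ π → ClassPreserving cl′ π → Lift (colourSig σ k) B (origin ∘ h) π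
    lift′ π cp′ = record
      { lifted    = lifted′
      ; commutes  = λ b → trans (cong origin (h-lifted b)) (commutes L (h b))
      ; preserves = preserves′ }
      where
      cp : ClassPreserving cl π
      cp = proj₁ ∘ cl′-injective ∘ cp′
      L = lift π cp
      α = lift-automorphism E π cp
      φ = Automorphism.perm α ⟨$⟩ʳ_
      colour-φ : ∀ a → c (φ a) ≡ c a
      colour-φ a = suc-injective (trans (sym (signature-origin (φ a) (commutes L a)))
        (trans (proj₂ (cl′-injective (cp′ _)) _) (signature-origin a refl)))
      lifted′ = Inverse.from e ∘ φ ∘ h
      h-lifted : ∀ b → h (lifted′ b) ≡ φ (h b)
      h-lifted b = Inverse.strictlyInverseˡ e _
      preserves′ : ∀ r v → B r (map lifted′ v) ≡ B r v
      preserves′ (inj₁ r) v = begin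
        B (inj₁ r) (map lifted′ v)  ≡⟨ rels r _ ⟩
        A r (map h (map lifted′ v)) ≡⟨ cong (A r) (map-commute h-lifted v) ⟩
        A r (map φ (map h v))       ≡⟨ Automorphism.preserves α r _ ⟩
        A r (map h v)               ≡⟨ rels r v ⟨
        B (inj₁ r) v                ∎
        where open ≡-Reasoning
      preserves′ (inj₂ i) (x ∷ []) =
        true-⇔⇒≡ (colours i _) (colours i _) (≡⇒⇔ (trans (cong c (h-lifted x)) (colour-φ (h x))))

stepLayers : ∀ {σ τ} → Step σ τ → ℕ → ℕ
stepLayers (copy k) P = P * suc k
stepLayers _        P = P

stepClasses : ∀ {σ τ} → Step σ τ → ℕ → ℕ → ℕ
stepClasses (colour k) P N = N * (suc k ^ P)
stepClasses _          P N = N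

layers : ∀ {σ τ} → Transduction σ τ → ℕ → ℕ
layers done       P = P
layers (s then t) P = layers t (stepLayers s P)

classes : ∀ {σ τ} → Transduction σ τ → ℕ → ℕ → ℕ
classes done       P N = N
classes (s then t) P N = classes t (stepLayers s P) (stepClasses s P N)

step-Equivariant : ∀ {σ τ m m′ n N P} {A : Structure σ m} {B : Structure τ m′} {cl : Fin n → Fin N}
  (s : Step σ τ) → StepRel s (m , A) (m′ , B) → Equivariant σ A cl P →
  Σ (Fin n → Fin (stepClasses s P N)) λ cl′ → Equivariant τ B cl′ (stepLayers s P)
step-Equivariant (interp I) AB E = _ , interp-Equivariant I AB E
step-Equivariant (filter φ) AB E = _ , iso-Equivariant (proj₂ AB) E
step-Equivariant (copy k)   AB E = _ , copy-Equivariant k AB E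
step-Equivariant (colour k) AB E = colour-Equivariant k AB E

⟦⟧-Equivariant : ∀ {σ τ m m′ n N P} {A : Structure σ m} {B : Structure τ m′} {cl : Fin n → Fin N}
  (t : Transduction σ τ) → ⟦ t ⟧ (m , A) (m′ , B) → Equivariant σ A cl P →
  Σ (Fin n → Fin (classes t P N)) λ cl′ → Equivariant τ B cl′ (layers t P)
⟦⟧-Equivariant done       AB                E = _ , iso-Equivariant AB E
⟦⟧-Equivariant (s then t) ((_ , C) , AC , CB) E =
  ⟦⟧-Equivariant t CB (proj₂ (step-Equivariant s AC E))

×-injective⇒≤ : ∀ {m a b} {f : Fin m → Fin a × Fin b} →
  (∀ {x y} → f x ≡ f y → x ≡ y) → m ≤ a * b
×-injective⇒≤ {f = f} f-injective =
  injective⇒≤ (f-injective ∘ ↔-injective (↔-sym *↔×))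

Equivariant-size : ∀ {σ m n N P} {B : Structure σ m} {cl : Fin n → Fin N} →
  Equivariant σ B cl P → m ≤ n * P
Equivariant-size E = ×-injective⇒≤ (Equivariant.origin-injective E)

⟦⟧-size : ∀ {σ τ m m′} {A : Structure σ m} {B : Structure τ m′} (t : Transduction σ τ) →
  ⟦ t ⟧ (m , A) (m′ , B) → m′ ≤ m * layers t 1
⟦⟧-size t A↦B = Equivariant-size (proj₂ (⟦⟧-Equivariant t A↦B (discrete-Equivariant _)))

-- Binary trees

module _ {m} {B : Structure treeSig m} (binary : IsBinaryTree (m , B)) (α : Automorphism treeSig B) where
  open Automorphism α
  private
    f = perm ⟨$⟩ʳ_

  cube≡id⇒≡id : (∀ b → f (f (f b)) ≡ b) → ∀ b → f b ≡ b
  cube≡id⇒≡id cube b = fixed-below (reach b) root-fixed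
    where
    root = proj₁ (proj₁ binary)
    orphan-root = proj₁ (proj₂ (proj₁ binary))
    has-parent = proj₁ (proj₂ (proj₂ (proj₁ binary)))
    reach = proj₂ (proj₂ (proj₂ (proj₁ binary)))
    at-most-two-children = proj₂ binary

    parent-f : ∀ {x y} → Parent B x y → Parent B (f x) (f y)
    parent-f {x} {y} = trans (preserves tt (x ∷ y ∷ []))

    parent-f⁻¹ : ∀ {x y} → Parent B (f x) (f y) → Parent B x y
    parent-f⁻¹ {x} {y} = trans (sym (preserves tt (x ∷ y ∷ [])))

    root-fixed : f root ≡ root
    root-fixed with f root ≟ root
    ... | yes fixed  = fixed
    ... | no  moved = ⊥-elim (orphan-root (perm ⟨$⟩ˡ x)
                        (parent-f⁻¹ (subst (λ z → Parent B z (f root)) (sym (inverseʳ perm)) x↦froot)))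
      where
      x = proj₁ (has-parent (f root) moved)
      x↦froot = proj₁ (proj₂ (has-parent (f root) moved))

    fixed-child : ∀ {x y} → Parent B x y → f x ≡ x → f y ≡ y
    -- y, f y and f (f y) are all children of x, which has at most two children.
    fixed-child {x} {y} x↦y fx≡x with at-most-two-children x y (f y) (f (f y)) x↦y x↦fy x↦ffy
      where
      x↦fy : Parent B x (f y)
      x↦fy = subst (λ z → Parent B z (f y)) fx≡x (parent-f x↦y)
      x↦ffy : Parent B x (f (f y))
      x↦ffy = subst (λ z → Parent B z (f (f y))) fx≡x (parent-f x↦fy)
    ... | inj₁ y≡fy         = sym y≡fy
    ... | inj₂ (inj₁ y≡ffy) = trans (cong f y≡ffy) (cube y)
    ... | inj₂ (inj₂ fy≡ffy) = sym (↔-injective perm fy≡ffy)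

    fixed-below : ∀ {x y} → Reach B x y → f x ≡ x → f y ≡ y
    fixed-below here         fx≡x = fx≡x
    fixed-below (step x↦z r) fx≡x = fixed-below r (fixed-child x↦z fx≡x)

module Rotation {n} {x y z : Fin n} (x≢y : x ≢ y) (y≢z : y ≢ z) (x≢z : x ≢ z) where

  rotate : Fin n → Fin n
  rotate w with w ≟ x | w ≟ y | w ≟ z
  ... | yes _ | _     | _     = y
  ... | no _  | yes _ | _     = z
  ... | no _  | no _  | yes _ = x
  ... | no _  | no _  | no _  = w

  by-cases : ∀ {ℓ} (Q : Fin n → Set ℓ) → Q x → Q y → Q z →
    (∀ w → w ≢ x → w ≢ y → w ≢ z → Q w) → ∀ w → Q w
  by-cases Q qx qy qz qw w with w ≟ x | w ≟ y | w ≟ z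
  ... | yes refl | _        | _        = qx
  ... | no _     | yes refl | _        = qy
  ... | no _     | no _     | yes refl = qz
  ... | no w≢x   | no w≢y   | no w≢z   = qw w w≢x w≢y w≢z

  rotate-x : rotate x ≡ y
  rotate-x with x ≟ x | x ≟ y | x ≟ z
  ... | yes _  | _ | _ = refl
  ... | no x≢x | _ | _ = ⊥-elim (x≢x refl)

  rotate-y : rotate y ≡ z
  rotate-y with y ≟ x | y ≟ y | y ≟ z
  ... | yes y≡x | _      | _ = ⊥-elim (x≢y (sym y≡x))
  ... | no _    | yes _  | _ = refl
  ... | no _    | no y≢y | _ = ⊥-elim (y≢y refl)

  rotate-z : rotate z ≡ x
  rotate-z with z ≟ x | z ≟ y | z ≟ z
  ... | yes z≡x | _       | _      = ⊥-elim (x≢z (sym z≡x))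
  ... | no _    | yes z≡y | _      = ⊥-elim (y≢z (sym z≡y))
  ... | no _    | no _    | yes _  = refl
  ... | no _    | no _    | no z≢z = ⊥-elim (z≢z refl)

  rotate-other : ∀ {w} → w ≢ x → w ≢ y → w ≢ z → rotate w ≡ w
  rotate-other {w} w≢x w≢y w≢z with w ≟ x | w ≟ y | w ≟ z
  ... | yes w≡x | _       | _       = ⊥-elim (w≢x w≡x)
  ... | no _    | yes w≡y | _       = ⊥-elim (w≢y w≡y)
  ... | no _    | no _    | yes w≡z = ⊥-elim (w≢z w≡z)
  ... | no _    | no _    | no _    = refl

  rotate³ : ∀ w → rotate (rotate (rotate w)) ≡ w
  rotate³ = by-cases (λ w → rotate (rotate (rotate w)) ≡ w)
    (trans (cong (rotate ∘ rotate) rotate-x) (trans (cong rotate rotate-y) rotate-z))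
    (trans (cong (rotate ∘ rotate) rotate-y) (trans (cong rotate rotate-z) rotate-x))
    (trans (cong (rotate ∘ rotate) rotate-z) (trans (cong rotate rotate-x) rotate-y))
    (λ w w≢x w≢y w≢z → trans (cong (rotate ∘ rotate) (rotate-other w≢x w≢y w≢z))
      (trans (cong rotate (rotate-other w≢x w≢y w≢z)) (rotate-other w≢x w≢y w≢z)))

  cycle : Permutation′ n
  cycle = permutation rotate (rotate ∘ rotate) rotate³ rotate³

  cycle-ClassPreserving : ∀ {N} {cl : Fin n → Fin N} →
    cl y ≡ cl x → cl z ≡ cl x → ClassPreserving cl cycle
  cycle-ClassPreserving {cl = cl} y~x z~x = by-cases (λ w → cl (rotate w) ≡ cl w)
    (trans (cong cl rotate-x) y~x)
    (trans (cong cl rotate-y) (trans z~x (sym y~x)))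
    (trans (cong cl rotate-z) (sym z~x))
    (λ w w≢x w≢y w≢z → cong cl (rotate-other w≢x w≢y w≢z))

module _ {m n N P} {B : Structure treeSig m} {cl : Fin n → Fin N}
         (binary : IsBinaryTree (m , B)) (E : Equivariant treeSig B cl P) where
  open Equivariant E

  node : Fin m → Fin n
  node = proj₁ ∘ origin

  no-three-classmates : ∀ b {y z} → node b ≢ y → y ≢ z → node b ≢ z →
    cl y ≡ cl (node b) → cl z ≡ cl (node b) → ⊥
  no-three-classmates b {y} {z} x≢y y≢z x≢z y~x z~x = x≢y (begin
    node b          ≡⟨ cong node (cube≡id⇒≡id binary α φ³≡id b) ⟨
    node (φ b)      ≡⟨ cong proj₁ (commutes L b) ⟩
    rotate (node b) ≡⟨ rotate-x ⟩
    y               ∎)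
    where
    open ≡-Reasoning
    open Rotation x≢y y≢z x≢z
    cp = cycle-ClassPreserving y~x z~x
    L = lift cycle cp
    α = lift-automorphism E cycle cp
    φ = lifted L
    φ³≡id : ∀ a → φ (φ (φ a)) ≡ a
    φ³≡id a = origin-injective (begin
      origin (φ (φ (φ a)))                        ≡⟨ commutes L _ ⟩
      map₁ rotate (origin (φ (φ a)))              ≡⟨ cong (map₁ rotate) (commutes L _) ⟩
      map₁ rotate (map₁ rotate (origin (φ a)))    ≡⟨ cong (map₁ rotate ∘ map₁ rotate) (commutes L a) ⟩
      map₁ (rotate ∘ rotate ∘ rotate) (origin a)  ≡⟨ cong (_, proj₂ (origin a)) (rotate³ _) ⟩
      origin a                                    ∎)

  private
    HasSmallerClassmate : Fin n → Set
    HasSmallerClassmate x = Σ (Fin n) λ y → y < x × cl y ≡ cl x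

    smaller-classmate? : ∀ x → Dec (HasSmallerClassmate x)
    smaller-classmate? x = any? λ y → (y <? x) ×-dec (cl y ≟ cl x)

    below-node-no-smaller-classmate : ∀ b {x} → x < node b → cl x ≡ cl (node b) →
      ¬ HasSmallerClassmate x
    below-node-no-smaller-classmate b x<x′ x~x′ (y , y<x , y~x) =
      no-three-classmates b (≢-sym (<⇒≢ x<x′)) (≢-sym (<⇒≢ y<x)) (≢-sym (<⇒≢ (<-trans y<x x<x′)))
        x~x′ (trans y~x x~x′)

    smaller-classmate-separates : ∀ b b′ → node b < node b′ → cl (node b) ≡ cl (node b′) →
      isYes (smaller-classmate? (node b)) ≢ isYes (smaller-classmate? (node b′))
    smaller-classmate-separates b b′ x<x′ x~x′ same-answer =
      below-node-no-smaller-classmate b′ x<x′ x~x′ (toWitness (subst T (sym same-answer)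
        (fromWitness {a? = smaller-classmate? _} (_ , x<x′ , x~x′))))

    -- A class contains at most two nodes carrying elements of B, so such a node is
    -- determined by its class and by whether it is the larger of the two.
    encode : Fin m → Fin N × Fin (2 * P)
    encode b = cl (node b) , combine (Inverse.from 2↔Bool (isYes (smaller-classmate? (node b))))
                                     (proj₂ (origin b))

    encode-injective : ∀ {b b′} → encode b ≡ encode b′ → b ≡ b′
    encode-injective {b} {b′} encode≡ = origin-injective (cong₂ _,_ same-node same-layer)
      where
      same-class = cong proj₁ encode≡
      rest≡ = combine-injective _ _ _ _ (cong proj₂ encode≡)
      same-answer = ↔-injective (↔-sym 2↔Bool) (proj₁ rest≡)
      same-layer = proj₂ rest≡
      same-node : node b ≡ node b′
      same-node with <-cmp (node b) (node b′)
      ... | tri< x<x′ _ _ = ⊥-elim (smaller-classmate-separates b b′ x<x′ same-class same-answer)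
      ... | tri≈ _ x≡x′ _ = x≡x′
      ... | tri> _ _ x>x′ =
        ⊥-elim (smaller-classmate-separates b′ b x>x′ (sym same-class) (sym same-answer))

  binary-Equivariant-size : m ≤ N * (2 * P)
  binary-Equivariant-size = ×-injective⇒≤ encode-injective

-- Stars

isRoot : ∀ {n} → Fin (suc n) → Bool
isRoot zero    = true
isRoot (suc _) = false

star : ∀ n → Structure treeSig (suc n)
star n tt (x ∷ y ∷ []) = isRoot x ∧ not (isRoot y)

star-height≤1 : ∀ n → IsTreeHeight≤1 (suc n , star n)
star-height≤1 n = (zero , (λ { zero () ; (suc _) () }) , has-parent , reach) , height≤1
  where
  has-parent : ∀ y → y ≢ zero →
    Σ (Fin (suc n)) λ x → Parent (star n) x y × (∀ x′ → Parent (star n) x′ y → x′ ≡ x)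
  has-parent zero    y≢0 = ⊥-elim (y≢0 refl)
  has-parent (suc y) _   = zero , refl , λ { zero _ → refl ; (suc _) () }
  reach : ∀ y → Reach (star n) zero y
  reach zero    = here
  reach (suc y) = step refl here
  height≤1 : ∀ x y z → Parent (star n) x y → Parent (star n) y z → ⊥
  height≤1 zero    zero    _ () _
  height≤1 (suc _) _       _ () _
  height≤1 _       (suc _) _ _  ()

rootClass : ∀ {n} → Fin (suc n) → Fin 2
rootClass = Inverse.from 2↔Bool ∘ isRoot

star-Equivariant : ∀ n → Equivariant treeSig (star n) rootClass 1
star-Equivariant n = symmetric-Equivariant λ { π cp tt (x ∷ y ∷ []) →
  cong₂ (λ u w → u ∧ not w) (isRoot-π π cp x) (isRoot-π π cp y) }
  where
  isRoot-π : ∀ π → ClassPreserving rootClass π → ∀ x → isRoot (π ⟨$⟩ʳ x) ≡ isRoot x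
  isRoot-π π cp x = ↔-injective (↔-sym 2↔Bool) (cp x)

binary-image-of-star-size : ∀ {n m} {B : Structure treeSig m} (f : Transduction treeSig treeSig) →
  ⟦ f ⟧ (suc n , star n) (m , B) → IsBinaryTree (m , B) → m ≤ classes f 1 2 * (2 * layers f 1)
binary-image-of-star-size {n} f star↦B binary =
  binary-Equivariant-size binary (proj₂ (⟦⟧-Equivariant f star↦B (star-Equivariant n)))

mainTheorem10 : ¬ (Σ (Transduction treeSig treeSig) λ f → IsMSOEncoding IsTreeHeight≤1 IsBinaryTree f)
mainTheorem10 (f , g , f-binary , _ , round-trip) = <-irrefl refl (begin-strict
  n               <⟨ n<1+n n ⟩
  suc n           ≤⟨ ⟦⟧-size g g-BS ⟩
  m * layers g 1  ≤⟨ *-monoˡ-≤ (layers g 1) (binary-image-of-star-size f f-SB B-binary) ⟩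
  n               ∎)
  where
  open ≤-Reasoning
  n = classes f 1 2 * (2 * layers f 1) * layers g 1
  S : Str treeSig
  S = suc n , star n
  through = from (round-trip S (star-height≤1 n) S) (Iso-refl treeSig S)
  m = proj₁ (proj₁ through)
  B = proj₂ (proj₁ through)
  f-SB = proj₁ (proj₂ through)
  g-BS = proj₂ (proj₂ through)
  B-binary = f-binary S (star-height≤1 n) (m , B) f-SB
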